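{- For every $n\ge3$, the cycle on $n$ vertices is $123$-representable.
   Context: A word is a finite sequence of letters from a totally ordered alphabet. Two letters $x,y$ alternate in a word $w$ if between any two occurrences of $x$ there is an occurrence of $y$ and between any two occurrences of $y$ there is an occurrence of $x$. A graph $G=(V,E)$ is represented by a word $w$ over $V$ if for all distinct $x,y\in V$, $x$ and $y$ alternate in $w$ if and only if $xy\in E$. A word is $123$-avoiding if it has no strictly increasing subsequence of length $3$. A graph is $123$-representable if, after labeling its vertices by distinct elements of a totally ordered set (any labeling may be chosen), it is represented by a $123$-avoiding word. -}

module Defs where

open import Data.Nat using (ℕ; suc; _%_; _≥_)
open import Data.Nat.DivMod
open import Data.Fin using (Fin; toℕ; _<_)
open import Data.List using (List; length; lookup)
open import Data.List.Membership.Propositional using (_∈_)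
open import Data.Product using (∃; ∃-syntax; _×_; _,_)
open import Data.Sum using (_⊎_)
open import Relation.Binary.PropositionalEquality using (_≡_; _≢_)
open import Relation.Nullary using (¬_)
open import Function.Bundles using (_⇔_)
open import Function.Definitions using (Injective)

Word : Set → Set
Word V = List V

Pos : {V : Set} → Word V → Set
Pos w = Fin (length w)

SeparatedBy : {V : Set} → Word V → V → V → Set
SeparatedBy w x y =
  (i j : Pos w) → i < j → lookup w i ≡ x → lookup w j ≡ x →
  ∃[ k ] (i < k × k < j × lookup w k ≡ y)

Alternate : {V : Set} → Word V → V → V → Set
Alternate w x y = SeparatedBy w x y × SeparatedBy w y x

Represents : {V : Set} → (V → V → Set) → Word V → Set
Represents {V} E w =
  ((x : V) → x ∈ w) ×
  ((x y : V) → x ≢ y → (Alternate w x y ⇔ E x y))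

Avoids123 : {V : Set} → (V → ℕ) → Word V → Set
Avoids123 w-lab w =
  ¬ (∃[ i ] ∃[ j ] ∃[ k ] (i < j × j < k ×
       (w-lab (lookup w i) Data.Nat.< w-lab (lookup w j)) ×
       (w-lab (lookup w j) Data.Nat.< w-lab (lookup w k))))

-- A graph (V, E) is 123-representable: there is a labeling of the vertices
-- by distinct elements of a totally ordered set (here ℕ; every finite
-- total order embeds into ℕ) and a 123-avoiding word representing it.
Representable123 : {V : Set} → (V → V → Set) → Set
Representable123 {V} E =
  ∃[ ℓ ] (Injective _≡_ _≡_ ℓ ×
    ∃[ w ] (Represents E w × Avoids123 {V} ℓ w))

CycleAdj : (n : ℕ) → Fin n → Fin n → Set
CycleAdj n x y =
  ((suc (toℕ x)) % suc (n Data.Nat.∸ 1) ≡ toℕ y) ⊎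
  ((suc (toℕ y)) % suc (n Data.Nat.∸ 1) ≡ toℕ x)

-- The cycle on the vertices 0, 1, …, M is represented by the word
--   1 0 2 1 3 2 … M (M−1),
-- i.e. the pairs (d+1, d) for d < M.  Each inner vertex 0 < a < M occurs
-- twice, with exactly a−1 and a+1 between its occurrences, while 0 and M
-- occur once and therefore alternate with each other (closing the cycle).
-- The only descents of the word are the pairs (d+1, d) at consecutive
-- positions, so it has no decreasing subsequence of length 3; labelling the
-- vertices in reverse order turns this into 123-avoidance.
module Submission where

open import Defs
open import Data.Nat using (ℕ; _≥_)
open import Data.Nat.Base using (zero; suc; _+_; _≤_; _<_; z≤n; s≤s; z<s; s<s⁻¹; _%_)
open import Data.Nat.Properties
open import Data.Nat.DivMod using (_mod_; m<n⇒m%n≡m; n%n≡0)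
open import Data.Fin.Base using (Fin; toℕ; fromℕ<; opposite)
open import Data.Fin.Properties
  using (toℕ-injective; toℕ-fromℕ<; toℕ<n; toℕ≤pred[n]; opposite-prop; opposite-involutive)
open import Data.List.Base using (applyUpTo; lookup; length)
open import Data.List.Properties using (length-applyUpTo; lookup-applyUpTo)
open import Data.List.Membership.Propositional using (_∈_)
open import Data.List.Membership.Propositional.Properties using (∈-applyUpTo⁺)
open import Data.Product.Base using (∃-syntax; _×_; _,_; swap)
open import Data.Product.Function.NonDependent.Propositional using (_×-⇔_)
open import Data.Sum.Base using (_⊎_; inj₁; inj₂)
import Data.Sum.Base as Sum
open import Data.Sum.Function.Propositional using (_⊎-⇔_)
open import Data.Empty using (⊥; ⊥-elim)
open import Function.Base using (_∘_)
open import Function.Bundles using (_⇔_; mk⇔; Equivalence)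
import Function.Properties.Equivalence as ⇔
open import Function.Definitions using (Injective)
open import Function.Related.Propositional using (module EquationalReasoning; Kind)
open import Relation.Binary.PropositionalEquality

zigzag : ℕ → ℕ
zigzag 0 = 1
zigzag 1 = 0
zigzag (suc (suc p)) = suc (zigzag p)

zigzag-even : ∀ d → zigzag (d + d) ≡ suc d
zigzag-even zero = refl
zigzag-even (suc d) rewrite +-suc d d = cong suc (zigzag-even d)

zigzag-odd : ∀ d → zigzag (suc (d + d)) ≡ d
zigzag-odd zero = refl
zigzag-odd (suc d) rewrite +-suc d d = cong suc (zigzag-odd d)

zigzag-≤ : ∀ {p M} → p < M + M → zigzag p ≤ M
zigzag-≤ {zero} {suc M} _ = s≤s z≤n
zigzag-≤ {suc zero} {suc M} _ = z≤n
zigzag-≤ {suc (suc p)} {suc M} (s≤s p<M+M) rewrite +-suc M M = s≤s (zigzag-≤ (≤-pred p<M+M))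

zigzag-repeat : ∀ {i j} → i < j → zigzag i ≡ zigzag j → ∃[ d ] (i ≡ d + d × j ≡ 3 + (d + d))
zigzag-repeat {zero} {3} _ _ = 0 , refl , refl
zigzag-repeat {zero} {suc (suc (suc (suc _)))} _ ()
zigzag-repeat {suc zero} {suc zero} (s≤s ()) _
zigzag-repeat {suc zero} {suc (suc _)} _ ()
zigzag-repeat {suc (suc i)} {suc (suc j)} (s≤s (s≤s i<j)) eq
  with zigzag-repeat i<j (suc-injective eq)
... | d , refl , refl = suc d , cong suc (sym (+-suc d d)) , cong (3 +_) (cong suc (sym (+-suc d d)))

zigzag-descent : ∀ {i j} → i < j → zigzag j < zigzag i → j ≡ suc i
zigzag-descent {zero} {suc zero} _ _ = refl
zigzag-descent {zero} {suc (suc _)} _ (s≤s ())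
zigzag-descent {suc (suc i)} {suc (suc j)} (s≤s (s≤s i<j)) (s≤s d) =
  cong (suc ∘ suc) (zigzag-descent i<j d)

zigzag-no-decreasing-triple : ∀ {i j k} → i < j → j < k →
  zigzag j < zigzag i → zigzag k < zigzag j → ⊥
zigzag-no-decreasing-triple i<j j<k ji kj
  with zigzag-descent i<j ji | zigzag-descent j<k kj
... | refl | refl = 1+n≰n (<⇒≤ (<-trans kj ji))

zigzag-surjective : ∀ {a M} → 0 < M → a ≤ M → ∃[ p ] (p < M + M × zigzag p ≡ a)
zigzag-surjective {zero} 0<M _ = 1 , +-mono-≤ 0<M 0<M , refl
zigzag-surjective {suc d} _ d<M = d + d , +-mono-< d<M d<M , zigzag-even d

-- SeparatedBy for the word f 0 ⋯ f (n − 1), with positions in ℕ rather than Fin.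
SeparatedIn : {V : Set} → (ℕ → V) → ℕ → V → V → Set
SeparatedIn f n x y =
  ∀ {p q} → p < q → q < n → f p ≡ x → f q ≡ x → ∃[ r ] (p < r × r < q × f r ≡ y)

strictly-between-3 : ∀ {p r} → p < r → r < 3 + p → r ≡ suc p ⊎ r ≡ 2 + p
strictly-between-3 {zero} {1} _ _ = inj₁ refl
strictly-between-3 {zero} {2} _ _ = inj₂ refl
strictly-between-3 {zero} {suc (suc (suc _))} _ (s≤s (s≤s (s≤s ())))
strictly-between-3 {suc p} {suc r} (s≤s p<r) (s≤s r<3+p) =
  Sum.map (cong suc) (cong suc) (strictly-between-3 p<r r<3+p)

module _ {n : ℕ} where

  zigzag-separated-suc : ∀ a → SeparatedIn zigzag n a (suc a)
  zigzag-separated-suc a p<q _ zp zq with zigzag-repeat p<q (trans zp (sym zq))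
  ... | d , refl , refl = 2 + (d + d) , m<n+m _ {2} z<s , ≤-refl , cong suc zp

  zigzag-separated-pred : ∀ a → SeparatedIn zigzag n (suc a) a
  zigzag-separated-pred a p<q _ zp zq with zigzag-repeat p<q (trans zp (sym zq))
  ... | d , refl , refl =
    suc (d + d) , ≤-refl , m<n+m _ {2} z<s ,
    trans (zigzag-odd d) (suc-injective (trans (sym (zigzag-even d)) zp))

  zigzag-separated-0 : ∀ b → SeparatedIn zigzag n 0 b
  zigzag-separated-0 b p<q _ zp zq with zigzag-repeat p<q (trans zp (sym zq))
  ... | d , refl , refl with trans (sym (zigzag-even d)) zp
  ... | ()

ZigzagSeparated : ℕ → ℕ → ℕ → Set
ZigzagSeparated M = SeparatedIn zigzag (M + M)

zigzag-separated-top : ∀ M b → ZigzagSeparated M M b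
zigzag-separated-top M b p<q q<M+M zp zq with zigzag-repeat p<q (trans zp (sym zq))
... | d , refl , refl with trans (sym zp) (zigzag-even d)
... | refl rewrite +-suc d d = ⊥-elim (<-irrefl refl (<-trans (n<1+n _) q<M+M))

-- suc d occurs at positions d + d and 3 + (d + d), which enclose exactly the letters d and d + 2.
zigzag-separators-inner : ∀ {M d b} → suc d < M → ZigzagSeparated M (suc d) b →
  b ≡ d ⊎ b ≡ 2 + d
zigzag-separators-inner {M} {d} 1+d<M separated
  with separated {d + d} {3 + (d + d)} (m<n+m _ {3} z<s) last<M+M
                 (zigzag-even d) (cong suc (zigzag-odd d))
  where
  last<M+M : 3 + (d + d) < M + M
  last<M+M = subst (_≤ M + M) (cong (2 +_) (trans (+-suc d (suc d)) (cong suc (+-suc d d))))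
                   (+-mono-≤ 1+d<M 1+d<M)
... | r , d+d<r , r<3+d+d , zr with strictly-between-3 d+d<r r<3+d+d
... | inj₁ refl = inj₁ (trans (sym zr) (zigzag-odd d))
... | inj₂ refl = inj₂ (trans (sym zr) (cong suc (zigzag-even d)))

CycleSucc : ℕ → ℕ → ℕ → Set
CycleSucc M a b = suc a ≡ b ⊎ (a ≡ M × b ≡ 0)

suc-%-⇔-CycleSucc : ∀ {M a b} → a ≤ M → b ≤ M → (suc a % suc M ≡ b) ⇔ CycleSucc M a b
suc-%-⇔-CycleSucc {M} {a} {b} a≤M b≤M = mk⇔ to from
  where
  to : suc a % suc M ≡ b → CycleSucc M a b
  to e with m≤n⇒m<n∨m≡n a≤M
  ... | inj₁ a<M = inj₁ (trans (sym (m<n⇒m%n≡m (s≤s a<M))) e)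
  ... | inj₂ refl = inj₂ (refl , trans (sym e) (n%n≡0 (suc M)))
  from : CycleSucc M a b → suc a % suc M ≡ b
  from (inj₁ refl) = m<n⇒m%n≡m (s≤s b≤M)
  from (inj₂ (refl , refl)) = n%n≡0 (suc M)

inner-or-end : ∀ {a M} → a ≤ M → (∃[ d ] (a ≡ suc d × suc d < M)) ⊎ (a ≡ 0 ⊎ a ≡ M)
inner-or-end {zero} _ = inj₂ (inj₁ refl)
inner-or-end {suc d} 1+d≤M with m≤n⇒m<n∨m≡n 1+d≤M
... | inj₁ 1+d<M = inj₁ (d , refl , 1+d<M)
... | inj₂ 1+d≡M = inj₂ (inj₂ 1+d≡M)

module _ {M : ℕ} where

  adjacent⇒separated : ∀ {a b} → CycleSucc M a b → ZigzagSeparated M a b × ZigzagSeparated M b a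
  adjacent⇒separated {a} (inj₁ refl) = zigzag-separated-suc a , zigzag-separated-pred a
  adjacent⇒separated (inj₂ (refl , refl)) = zigzag-separated-top M 0 , zigzag-separated-0 M

  separated-inner⇒adjacent : ∀ {d b} → suc d < M → ZigzagSeparated M (suc d) b →
    CycleSucc M (suc d) b ⊎ CycleSucc M b (suc d)
  separated-inner⇒adjacent 1+d<M separated with zigzag-separators-inner 1+d<M separated
  ... | inj₁ refl = inj₂ (inj₁ refl)
  ... | inj₂ refl = inj₁ (inj₁ refl)

  separated⇒adjacent : ∀ {a b} → a ≤ M → b ≤ M → a ≢ b →
    ZigzagSeparated M a b → ZigzagSeparated M b a → CycleSucc M a b ⊎ CycleSucc M b a
  separated⇒adjacent a≤M b≤M a≢b ab ba with inner-or-end a≤M | inner-or-end b≤M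
  ... | inj₁ (_ , refl , 1+d<M) | _ = separated-inner⇒adjacent 1+d<M ab
  ... | inj₂ _ | inj₁ (_ , refl , 1+d<M) = Sum.swap (separated-inner⇒adjacent 1+d<M ba)
  ... | inj₂ (inj₁ refl) | inj₂ (inj₁ refl) = ⊥-elim (a≢b refl)
  ... | inj₂ (inj₁ refl) | inj₂ (inj₂ refl) = inj₂ (inj₂ (refl , refl))
  ... | inj₂ (inj₂ refl) | inj₂ (inj₁ refl) = inj₁ (inj₂ (refl , refl))
  ... | inj₂ (inj₂ refl) | inj₂ (inj₂ refl) = ⊥-elim (a≢b refl)

  zigzag-alternation : ∀ {a b} → a ≤ M → b ≤ M → a ≢ b →
    (ZigzagSeparated M a b × ZigzagSeparated M b a) ⇔ (CycleSucc M a b ⊎ CycleSucc M b a)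
  zigzag-alternation a≤M b≤M a≢b = mk⇔
    (λ (ab , ba) → separated⇒adjacent a≤M b≤M a≢b ab ba)
    (Sum.[ adjacent⇒separated , swap ∘ adjacent⇒separated ])

module _ {V : Set} (f : ℕ → V) (n : ℕ) where

  private
    w : Word V
    w = applyUpTo f n

    index : ∀ {p} → p < n → ∃[ i ] (toℕ {length w} i ≡ p)
    index {p} p<n = fromℕ< (subst (p <_) (sym (length-applyUpTo f n)) p<n) , toℕ-fromℕ< _

  toℕ<applyUpTo-length : (i : Pos w) → toℕ i < n
  toℕ<applyUpTo-length i = subst (toℕ i <_) (length-applyUpTo f n) (toℕ<n i)

  SeparatedBy-applyUpTo : ∀ {x y} → SeparatedBy w x y ⇔ SeparatedIn f n x y
  SeparatedBy-applyUpTo {x} {y} = mk⇔ to from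
    where
    to : SeparatedBy w x y → SeparatedIn f n x y
    to separated p<q q<n fp fq with index (<-trans p<q q<n) | index q<n
    ... | i , refl | j , refl
      with separated i j p<q (trans (lookup-applyUpTo f n i) fp) (trans (lookup-applyUpTo f n j) fq)
    ... | k , i<k , k<j , wk = toℕ k , i<k , k<j , trans (sym (lookup-applyUpTo f n k)) wk
    from : SeparatedIn f n x y → SeparatedBy w x y
    from separated i j i<j wi wj
      with separated i<j (toℕ<applyUpTo-length j) (trans (sym (lookup-applyUpTo f n i)) wi)
                                     (trans (sym (lookup-applyUpTo f n j)) wj)
    ... | r , i<r , r<j , fr with index (<-trans r<j (toℕ<applyUpTo-length j))
    ... | k , refl = k , i<r , r<j , trans (lookup-applyUpTo f n k) fr

SeparatedIn-cong : ∀ {V W : Set} {f : ℕ → V} {g : ℕ → W} {n x y a b} →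
  (∀ {p} → p < n → (f p ≡ x) ⇔ (g p ≡ a)) → (∀ {p} → p < n → (f p ≡ y) ⇔ (g p ≡ b)) →
  SeparatedIn f n x y ⇔ SeparatedIn g n a b
SeparatedIn-cong x⇔a y⇔b =
  mk⇔ (transport x⇔a y⇔b) (transport (⇔.sym ∘ x⇔a) (⇔.sym ∘ y⇔b))
  where
  transport : ∀ {V W : Set} {f : ℕ → V} {g : ℕ → W} {n x y a b} →
    (∀ {p} → p < n → (f p ≡ x) ⇔ (g p ≡ a)) → (∀ {p} → p < n → (f p ≡ y) ⇔ (g p ≡ b)) →
    SeparatedIn f n x y → SeparatedIn g n a b
  transport x⇔a y⇔b separated p<q q<n gp gq
    with separated p<q q<n (Equivalence.from (x⇔a (<-trans p<q q<n)) gp)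
                           (Equivalence.from (x⇔a q<n) gq)
  ... | r , p<r , r<q , fr = r , p<r , r<q , Equivalence.to (y⇔b (<-trans r<q q<n)) fr

letter : (M : ℕ) → ℕ → Fin (suc M)
letter M p = zigzag p mod suc M

toℕ-letter : ∀ {M p} → p < M + M → toℕ (letter M p) ≡ zigzag p
toℕ-letter p<M+M = trans (toℕ-fromℕ< _) (m<n⇒m%n≡m (s≤s (zigzag-≤ p<M+M)))

letter≡⇔zigzag≡ : ∀ {M p} (x : Fin (suc M)) → p < M + M → (letter M p ≡ x) ⇔ (zigzag p ≡ toℕ x)
letter≡⇔zigzag≡ x p<M+M = mk⇔
  (λ e → trans (sym (toℕ-letter p<M+M)) (cong toℕ e))
  (λ e → toℕ-injective (trans (toℕ-letter p<M+M) e))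

zigzagWord : (M : ℕ) → Word (Fin (suc M))
zigzagWord M = applyUpTo (letter M) (M + M)

zigzagWord-alternation : ∀ {M} (x y : Fin (suc M)) → x ≢ y →
  Alternate (zigzagWord M) x y ⇔ CycleAdj (suc M) x y
zigzagWord-alternation {M} x y x≢y = begin
  Alternate (zigzagWord M) x y
    ∼⟨ SeparatedBy-applyUpTo _ _ ×-⇔ SeparatedBy-applyUpTo _ _ ⟩
  (SeparatedIn (letter M) (M + M) x y × SeparatedIn (letter M) (M + M) y x)
    ∼⟨ SeparatedIn-cong (letter≡⇔zigzag≡ x) (letter≡⇔zigzag≡ y)
       ×-⇔ SeparatedIn-cong (letter≡⇔zigzag≡ y) (letter≡⇔zigzag≡ x) ⟩
  (ZigzagSeparated M (toℕ x) (toℕ y) × ZigzagSeparated M (toℕ y) (toℕ x))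
    ∼⟨ zigzag-alternation x≤M y≤M (x≢y ∘ toℕ-injective) ⟩
  (CycleSucc M (toℕ x) (toℕ y) ⊎ CycleSucc M (toℕ y) (toℕ x))
    ∼⟨ ⇔.sym (suc-%-⇔-CycleSucc x≤M y≤M ⊎-⇔ suc-%-⇔-CycleSucc y≤M x≤M) ⟩
  CycleAdj (suc M) x y ∎
  where
  open EquationalReasoning {k = Kind.equivalence}
  x≤M = toℕ≤pred[n] x
  y≤M = toℕ≤pred[n] y

toℕ-lookup-zigzagWord : ∀ {M} (i : Pos (zigzagWord M)) →
  toℕ (lookup (zigzagWord M) i) ≡ zigzag (toℕ i)
toℕ-lookup-zigzagWord {M} i =
  trans (cong toℕ (lookup-applyUpTo (letter M) (M + M) i))
        (toℕ-letter (toℕ<applyUpTo-length (letter M) (M + M) i))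

zigzagWord-complete : ∀ {M} → 0 < M → (x : Fin (suc M)) → x ∈ zigzagWord M
zigzagWord-complete {M} 0<M x with zigzag-surjective 0<M (toℕ≤pred[n] x)
... | p , p<M+M , zp =
  subst (_∈ zigzagWord M) (Equivalence.from (letter≡⇔zigzag≡ x p<M+M) zp)
        (∈-applyUpTo⁺ (letter M) p<M+M)

opposite-<⇒> : ∀ {n} {i j : Fin n} → toℕ (opposite i) < toℕ (opposite j) → toℕ j < toℕ i
opposite-<⇒> {n} {i} {j} lt =
  s<s⁻¹ (∸-cancelʳ-< {o = n} (subst₂ _<_ (opposite-prop i) (opposite-prop j) lt))

toℕ∘opposite-injective : ∀ {n} → Injective _≡_ _≡_ (toℕ ∘ opposite {n})
toℕ∘opposite-injective {x = i} {j} e =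
  trans (sym (opposite-involutive i)) (trans (cong opposite (toℕ-injective e)) (opposite-involutive j))

zigzagWord-avoids123 : ∀ M → Avoids123 (toℕ ∘ opposite) (zigzagWord M)
zigzagWord-avoids123 M (i , j , k , i<j , j<k , ij , jk) =
  zigzag-no-decreasing-triple i<j j<k (descent ij) (descent jk)
  where
  w = zigzagWord M

  descent : ∀ {i j : Pos w} → toℕ (opposite (lookup w i)) < toℕ (opposite (lookup w j)) →
    zigzag (toℕ j) < zigzag (toℕ i)
  descent {i} {j} lt = subst₂ _<_ (toℕ-lookup-zigzagWord j) (toℕ-lookup-zigzagWord i)
                                  (opposite-<⇒> {i = lookup w i} {lookup w j} lt)

theorem3p11 : (n : ℕ) → n ≥ 3 → Representable123 (CycleAdj n)
theorem3p11 (suc M) (s≤s 1<M) =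
  toℕ ∘ opposite , toℕ∘opposite-injective ,
  zigzagWord M , (zigzagWord-complete (<-trans z<s 1<M) , zigzagWord-alternation) ,
  zigzagWord-avoids123 M
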